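{- Let $\mathcal{B}_n(P)$ denote the set of t-shelves of size $n$ in which no node that is a left child of its parent has a right child (i.e. t-shelves avoiding the pattern $P$ given by the size-3 t-shelf with root $1$, left child $2$, and $3$ the right child of $2$). Let $c_{n,k}$ be the number of t-shelves in $\mathcal{B}_n(P)$ having exactly $k$ left children. Then $$\sum_{n\ge 0}\sum_{k\ge 0} c_{n,k}\,\frac{z^n y^k}{n!} = e^{\frac{e^{zy}-1}{y}}.$$
   Context: A treeshelf (t-shelf) of size $n\ge 1$ is a rooted binary tree with $n$ nodes labeled bijectively by $\{1,\dots,n\}$ so that labels strictly increase along every path starting at the root, in which every node has at most one left child and at most one right child, and every child (including a child with no sibling) is designated either as the left child or the right child of its parent. There is a unique empty t-shelf, of size $0$. A left child is a node that is the left child of its parent; the number of left children of a t-shelf is the number of such nodes. -}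

module Defs where

open import Data.Nat as ℕ using (ℕ; zero; suc; _<_; _∸_; _!)
open import Data.Nat.Properties using (_!≢0)
open import Data.Integer using (+_)
open import Data.Rational using (ℚ; 0ℚ; 1ℚ; _+_; _*_; _-_; _/_)
open import Data.List using (List; []; _∷_; _++_; applyUpTo)
open import Data.List.Relation.Binary.Permutation.Propositional using (_↭_)
open import Data.Unit using (⊤)
open import Data.Product using (_×_)
open import Relation.Binary.PropositionalEquality using (_≡_)
open import Relation.Nullary using (yes; no)

-- A (possibly empty) binary tree with natural-number labels; in
-- `node a l r`, `l` is the left subtree (left child = its root, if any)
-- and `r` is the right subtree.  `leaf` is the empty tree.
data Tree : Set where
  leaf : Tree
  node : ℕ → Tree → Tree → Tree

labels : Tree → List ℕ
labels leaf         = []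
labels (node a l r) = a ∷ (labels l ++ labels r)

Above : ℕ → Tree → Set
Above a leaf         = ⊤
Above a (node b _ _) = a < b

Increasing : Tree → Set
Increasing leaf         = ⊤
Increasing (node a l r) = Above a l × Above a r × Increasing l × Increasing r

IsTShelf : ℕ → Tree → Set
IsTShelf n t = Increasing t × (labels t ↭ applyUpTo suc n)

nonEmpty : Tree → ℕ
nonEmpty leaf         = 0
nonEmpty (node _ _ _) = 1

leftChildren : Tree → ℕ
leftChildren leaf         = 0
leftChildren (node _ l r) = nonEmpty l ℕ.+ leftChildren l ℕ.+ leftChildren r

NoRightChild : Tree → Set
NoRightChild leaf         = ⊤
NoRightChild (node _ _ r) = r ≡ leaf

AvoidsP : Tree → Set
AvoidsP leaf         = ⊤
AvoidsP (node _ l r) = NoRightChild l × AvoidsP l × AvoidsP r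

-- Formal power series in z, y over ℚ : coefficient of z^n y^k

PS : Set
PS = ℕ → ℕ → ℚ

sumTo : ℕ → (ℕ → ℚ) → ℚ
sumTo zero    f = f 0
sumTo (suc n) f = sumTo n f + f (suc n)

onePS : PS
onePS zero zero = 1ℚ
onePS _    _    = 0ℚ

mulPS : PS → PS → PS
mulPS F G n k = sumTo n (λ i → sumTo k (λ j → F i j * G (n ∸ i) (k ∸ j)))

powPS : PS → ℕ → PS
powPS F zero    = onePS
powPS F (suc j) = mulPS F (powPS F j)

invFact : ℕ → ℚ
invFact n = (+ 1) / (n !) where instance _ = n !≢0

-- exp(F) = Σ_j F^j / j!, for F with no pure-y terms (F 0 k = 0); then
-- F^j has z-degree ≥ j, so the coefficient of z^n needs only j ≤ n.
expPS : PS → PS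
expPS F n k = sumTo n (λ j → powPS F j n k * invFact j)

ezy : PS
ezy n k with n ℕ.≟ k
... | yes _ = invFact n
... | no  _ = 0ℚ

subPS : PS → PS → PS
subPS F G n k = F n k - G n k

-- division by y (valid for series with no y^0 terms)
divY : PS → PS
divY G n k = G n (suc k)

targetPS : PS
targetPS = expPS (divY (subPS ezy onePS))

module Submission where

-- Both sides are identified with one number,
-- shelfCount n k, defined by the recurrence
--   c(n+1, k+1) = c(n, k+1) + (n - k) c(n, k).
--
-- Series side (Counting, Fractions, Series): with F = (e^{zy} - 1)/y,
-- the coefficient of z^n y^k in F^j is [k + j = n] surj j n / n!, where
-- surj j n is defined by the convolution that F·F^j produces.  Pascal's
-- rule turns this convolution into the Stirling recurrence, so
-- surj j n = j! S(n, j), and summing F^j / j! leaves S(n, n-k) / n!,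
-- which equals shelfCount n k / n!.
--
-- Tree side (ListFacts, Insertion, Enumeration): in an avoiding t-shelf
-- the largest label n+1 is either a new node at the end of the right
-- spine or the bottom of the left chain of one of the spine nodes.
-- Inserting n+1 in these ways is injective and reversible, which yields
-- a duplicate-free list of all avoiding t-shelves of size n with k left
-- children, of length shelfCount n k.  Any other such list has the same
-- length, which gives the theorem.

open import Defs
open import Data.Nat using (ℕ; _!)
open import Data.Nat.Properties using (_!≢0)
open import Data.Integer using (+_)
open import Data.Rational using (ℚ; _/_)
open import Data.List using (List; length)
open import Data.List.Membership.Propositional using (_∈_)
open import Data.List.Relation.Unary.Unique.Propositional using (Unique)
open import Data.Product using (_×_)
open import Function.Bundles using (_⇔_)
open import Relation.Binary.PropositionalEquality using (_≡_)

module Counting where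

  open import Data.Nat using (ℕ; zero; suc; _+_; _*_; _∸_; _≤_; _<_; _!; z≤n; s≤s)
  open import Data.Nat.Properties
  open import Data.Nat.Combinatorics using (_C_; nCk+nC[k+1]≡[n+1]C[k+1]; k>n⇒nCk≡0; k![n∸k]!∣n!)
  open import Data.Nat.Combinatorics.Specification using (nCk≡n!/k![n-k]!)
  open import Data.Nat.DivMod using (m/n*n≡m)
  open import Data.Nat.Tactic.RingSolver using (solve-∀)
  open import Data.Sum using (inj₁; inj₂)
  open import Relation.Binary.PropositionalEquality

  sumBelow : ℕ → (ℕ → ℕ) → ℕ
  sumBelow zero    f = 0
  sumBelow (suc n) f = sumBelow n f + f n

  sumBelow-cong : ∀ n {f g} → (∀ i → i < n → f i ≡ g i) → sumBelow n f ≡ sumBelow n g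
  sumBelow-cong zero    f≗g = refl
  sumBelow-cong (suc n) f≗g =
    cong₂ _+_ (sumBelow-cong n (λ i i<n → f≗g i (m<n⇒m<1+n i<n))) (f≗g n ≤-refl)

  sumBelow-+ : ∀ n f g → sumBelow n (λ i → f i + g i) ≡ sumBelow n f + sumBelow n g
  sumBelow-+ zero    f g = refl
  sumBelow-+ (suc n) f g rewrite sumBelow-+ n f g = interchange (sumBelow n f) (sumBelow n g) (f n) (g n)
    where interchange : ∀ a b c d → a + b + (c + d) ≡ a + c + (b + d)
          interchange = solve-∀

  sumBelow-* : ∀ n c f → sumBelow n (λ i → c * f i) ≡ c * sumBelow n f
  sumBelow-* zero    c f = sym (*-zeroʳ c)
  sumBelow-* (suc n) c f rewrite sumBelow-* n c f = sym (*-distribˡ-+ c (sumBelow n f) (f n))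

  sumBelow-zero : ∀ n {f} → (∀ i → i < n → f i ≡ 0) → sumBelow n f ≡ 0
  sumBelow-zero n f≗0 = trans (sumBelow-cong n f≗0) (zeros n)
    where zeros : ∀ n → sumBelow n (λ _ → 0) ≡ 0
          zeros zero    = refl
          zeros (suc n) = trans (+-identityʳ (sumBelow n (λ _ → 0))) (zeros n)

  sumBelow-first : ∀ n f → sumBelow (suc n) f ≡ f 0 + sumBelow n (λ i → f (suc i))
  sumBelow-first zero    f = sym (+-identityʳ (f 0))
  sumBelow-first (suc n) f rewrite sumBelow-first n f = +-assoc (f 0) _ _

  -- surj j n counts surjections from an n-set onto {1,…,j}, via the
  -- convolution "choose the (nonempty) preimage of the last point"; this
  -- is the numerator of the coefficient of z^n in F^j for F = e^z - 1.
  surj : ℕ → ℕ → ℕ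
  surj zero    zero    = 1
  surj zero    (suc n) = 0
  surj (suc j) n       = sumBelow n (λ i → (n C suc i) * surj j (n ∸ suc i))

  -- Pascal's rule turns the convolution into the usual recurrence
  -- surj (j+1) (n+1) = (j+1) (surj (j+1) n + surj j n).
  surj-rec : ∀ j n → surj (suc j) (suc n) ≡ suc j * (surj (suc j) n + surj j n)

  -- the part of surj (j+1) (n+1) coming from the second Pascal summand
  surj-tail : ∀ j n → sumBelow n (λ i → (n C suc i) * surj j (suc (n ∸ suc i)))
                      ≡ j * (surj (suc j) n + surj j n)
  surj-tail zero    n = sumBelow-zero n (λ i _ → *-zeroʳ (n C suc i))
  surj-tail (suc j) n = begin
      sumBelow n (λ i → (n C suc i) * surj (suc j) (suc (n ∸ suc i)))
    ≡⟨ sumBelow-cong n (λ i _ → cong ((n C suc i) *_) (surj-rec j (n ∸ suc i))) ⟩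
      sumBelow n (λ i → (n C suc i) * (suc j * (surj (suc j) (n ∸ suc i) + surj j (n ∸ suc i))))
    ≡⟨ sumBelow-cong n (λ i _ → distribute (n C suc i) (suc j) _ _) ⟩
      sumBelow n (λ i → suc j * ((n C suc i) * surj (suc j) (n ∸ suc i))
                      + suc j * ((n C suc i) * surj j (n ∸ suc i)))
    ≡⟨ sumBelow-+ n _ _ ⟩
      sumBelow n (λ i → suc j * ((n C suc i) * surj (suc j) (n ∸ suc i)))
        + sumBelow n (λ i → suc j * ((n C suc i) * surj j (n ∸ suc i)))
    ≡⟨ cong₂ _+_ (sumBelow-* n (suc j) _) (sumBelow-* n (suc j) _) ⟩
      suc j * surj (suc (suc j)) n + suc j * surj (suc j) n
    ≡⟨ *-distribˡ-+ (suc j) (surj (suc (suc j)) n) (surj (suc j) n) ⟨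
      suc j * (surj (suc (suc j)) n + surj (suc j) n) ∎
    where open ≡-Reasoning
          distribute : ∀ c s a b → c * (s * (a + b)) ≡ s * (c * a) + s * (c * b)
          distribute = solve-∀

  surj-rec j n = begin
      sumBelow (suc n) (λ i → (suc n C suc i) * surj j (n ∸ i))
    ≡⟨ sumBelow-cong (suc n) (λ i _ → cong (_* surj j (n ∸ i)) (sym (nCk+nC[k+1]≡[n+1]C[k+1] n i))) ⟩
      sumBelow (suc n) (λ i → (n C i + n C suc i) * surj j (n ∸ i))
    ≡⟨ sumBelow-cong (suc n) (λ i _ → *-distribʳ-+ (surj j (n ∸ i)) (n C i) _) ⟩
      sumBelow (suc n) (λ i → (n C i) * surj j (n ∸ i) + (n C suc i) * surj j (n ∸ i))
    ≡⟨ sumBelow-+ (suc n) _ _ ⟩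
      sumBelow (suc n) (λ i → (n C i) * surj j (n ∸ i))
        + sumBelow (suc n) (λ i → (n C suc i) * surj j (n ∸ i))
    ≡⟨ cong₂ _+_ first-part second-part ⟩
      (surj j n + surj (suc j) n) + j * (surj (suc j) n + surj j n)
    ≡⟨ collect j (surj j n) (surj (suc j) n) ⟩
      suc j * (surj (suc j) n + surj j n) ∎
    where
    open ≡-Reasoning
    collect : ∀ j a b → a + b + j * (b + a) ≡ suc j * (b + a)
    collect = solve-∀
    first-part : sumBelow (suc n) (λ i → (n C i) * surj j (n ∸ i)) ≡ surj j n + surj (suc j) n
    first-part = trans (sumBelow-first n _) (cong (_+ surj (suc j) n) (+-identityʳ (surj j n)))
    -- the last summand vanishes (n C n+1 = 0); reindex the others
    second-part : sumBelow (suc n) (λ i → (n C suc i) * surj j (n ∸ i))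
                  ≡ j * (surj (suc j) n + surj j n)
    second-part = begin
        sumBelow n (λ i → (n C suc i) * surj j (n ∸ i)) + (n C suc n) * surj j (n ∸ n)
      ≡⟨ cong (λ c → sumBelow n (λ i → (n C suc i) * surj j (n ∸ i)) + c * surj j (n ∸ n))
              (k>n⇒nCk≡0 (n<1+n n)) ⟩
        sumBelow n (λ i → (n C suc i) * surj j (n ∸ i)) + 0
      ≡⟨ +-identityʳ _ ⟩
        sumBelow n (λ i → (n C suc i) * surj j (n ∸ i))
      ≡⟨ sumBelow-cong n (λ i i<n → cong (λ m → (n C suc i) * surj j m) (+-∸-assoc 1 i<n)) ⟩
        sumBelow n (λ i → (n C suc i) * surj j (suc (n ∸ suc i)))
      ≡⟨ surj-tail j n ⟩
        j * (surj (suc j) n + surj j n) ∎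

  stirling : ℕ → ℕ → ℕ
  stirling zero    zero    = 1
  stirling zero    (suc j) = 0
  stirling (suc n) zero    = 0
  stirling (suc n) (suc j) = suc j * stirling n (suc j) + stirling n j

  surj≡j!*stirling : ∀ j n → surj j n ≡ j ! * stirling n j
  surj≡j!*stirling zero    zero    = refl
  surj≡j!*stirling (suc j) zero    = sym (*-zeroʳ (suc j !))
  surj≡j!*stirling zero    (suc n) = refl
  surj≡j!*stirling (suc j) (suc n)
    rewrite surj-rec j n | surj≡j!*stirling (suc j) n | surj≡j!*stirling j n =
    regroup (suc j) (j !) (stirling n (suc j)) (stirling n j)
    where regroup : ∀ s f a b → s * (s * f * a + f * b) ≡ s * f * (s * a + b)
          regroup = solve-∀

  stirling-vanish : ∀ n j → n < j → stirling n j ≡ 0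
  stirling-vanish zero    (suc j) _ = refl
  stirling-vanish (suc n) (suc j) (s≤s n<j)
    rewrite stirling-vanish n (suc j) (m<n⇒m<1+n n<j) | stirling-vanish n j n<j =
    trans (+-identityʳ _) (*-zeroʳ (suc j))

  surj-vanish : ∀ j m → m < j → surj j m ≡ 0
  surj-vanish j m m<j rewrite surj≡j!*stirling j m | stirling-vanish m j m<j = *-zeroʳ (j !)

  -- shelfCount n k satisfies the recurrence of avoiding t-shelves of size n
  -- with k left children, obtained by inserting the largest label
  shelfCount : ℕ → ℕ → ℕ
  shelfCount zero    zero    = 1
  shelfCount zero    (suc k) = 0
  shelfCount (suc n) zero    = shelfCount n zero
  shelfCount (suc n) (suc k) = shelfCount n (suc k) + (n ∸ k) * shelfCount n k

  shelfCount-vanish : ∀ n k → n < k → shelfCount n k ≡ 0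
  shelfCount-vanish zero    (suc k) _ = refl
  shelfCount-vanish (suc n) (suc k) (s≤s n<k)
    rewrite shelfCount-vanish n (suc k) (m<n⇒m<1+n n<k) | shelfCount-vanish n k n<k = *-zeroʳ (n ∸ k)

  -- a t-shelf with k left children has n - k blocks: c(n,k) = S(n, n-k)
  shelfCount≡stirling : ∀ n k → k ≤ n → shelfCount n k ≡ stirling n (n ∸ k)
  shelfCount≡stirling zero    zero    _ = refl
  shelfCount≡stirling (suc n) zero    _
    rewrite shelfCount≡stirling n zero z≤n | stirling-vanish n (suc n) (n<1+n n) | *-zeroʳ n = refl
  shelfCount≡stirling (suc n) (suc k) (s≤s k≤n) with m≤n⇒m<n∨m≡n k≤n
  ... | inj₂ refl rewrite shelfCount-vanish k (suc k) (n<1+n k) | n∸n≡0 k = refl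
  ... | inj₁ k<n
    rewrite shelfCount≡stirling n (suc k) k<n | shelfCount≡stirling n k k≤n | +-∸-assoc 1 k<n =
    +-comm (stirling n (n ∸ suc k)) _

  binomial-factorials : ∀ n i → i ≤ n → (n C i) * (i ! * (n ∸ i) !) ≡ n !
  binomial-factorials n i i≤n rewrite nCk≡n!/k![n-k]! i≤n = m/n*n≡m {{_}} (k![n∸k]!∣n! i≤n)

module Fractions where

  open import Data.Nat as ℕ using (suc; NonZero)
  import Data.Nat.Properties as ℕ
  open import Data.Integer as ℤ using (+_)
  import Data.Integer.Properties as ℤ
  open import Data.Rational using (ℚ; 0ℚ; _+_; _*_; _/_; fromℚᵘ)
  import Data.Rational.Properties as ℚ
  open import Data.Rational.Unnormalised as ℚᵘ using (mkℚᵘ; *≡*)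
  import Data.Rational.Unnormalised.Properties as ℚᵘ
  open import Relation.Binary.PropositionalEquality

  frac : ℕ → (d : ℕ) → .{{NonZero d}} → ℚ
  frac a d = (+ a) / d

  frac-cross : ∀ a b d e .{{_ : NonZero d}} .{{_ : NonZero e}} →
               a ℕ.* e ≡ b ℕ.* d → frac a d ≡ frac b e
  frac-cross a b (suc d) (suc e) eq = ℚ.fromℚᵘ-cong {mkℚᵘ (+ a) d} {mkℚᵘ (+ b) e} (*≡* (begin
      + a ℤ.* + suc e  ≡⟨ ℤ.pos-* a (suc e) ⟨
      + (a ℕ.* suc e)  ≡⟨ cong +_ eq ⟩
      + (b ℕ.* suc d)  ≡⟨ ℤ.pos-* b (suc d) ⟩
      + b ℤ.* + suc d  ∎))
    where open ≡-Reasoning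

  fromℚᵘ-+ : ∀ p q → fromℚᵘ p + fromℚᵘ q ≡ fromℚᵘ (p ℚᵘ.+ q)
  fromℚᵘ-+ p q = ℚ.toℚᵘ-injective (ℚᵘ.≃-trans (ℚ.toℚᵘ-homo-+ (fromℚᵘ p) (fromℚᵘ q))
    (ℚᵘ.≃-trans (ℚᵘ.+-cong (ℚ.toℚᵘ-fromℚᵘ p) (ℚ.toℚᵘ-fromℚᵘ q)) (ℚᵘ.≃-sym (ℚ.toℚᵘ-fromℚᵘ (p ℚᵘ.+ q)))))

  fromℚᵘ-* : ∀ p q → fromℚᵘ p * fromℚᵘ q ≡ fromℚᵘ (p ℚᵘ.* q)
  fromℚᵘ-* p q = ℚ.toℚᵘ-injective (ℚᵘ.≃-trans (ℚ.toℚᵘ-homo-* (fromℚᵘ p) (fromℚᵘ q))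
    (ℚᵘ.≃-trans (ℚᵘ.*-cong (ℚ.toℚᵘ-fromℚᵘ p) (ℚ.toℚᵘ-fromℚᵘ q)) (ℚᵘ.≃-sym (ℚ.toℚᵘ-fromℚᵘ (p ℚᵘ.* q)))))

  frac-* : ∀ a b d e .{{_ : NonZero d}} .{{_ : NonZero e}} →
           frac a d * frac b e ≡ frac (a ℕ.* b) (d ℕ.* e) {{ℕ.m*n≢0 d e}}
  frac-* a b (suc d) (suc e) = trans (fromℚᵘ-* (mkℚᵘ (+ a) d) (mkℚᵘ (+ b) e))
    (cong (_/ (suc d ℕ.* suc e)) (sym (ℤ.pos-* a b)))

  frac-+ : ∀ a b d .{{_ : NonZero d}} → frac a d + frac b d ≡ frac (a ℕ.+ b) d
  frac-+ a b d@(suc d-1) = begin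
      frac a d + frac b d
    ≡⟨ fromℚᵘ-+ (mkℚᵘ (+ a) d-1) (mkℚᵘ (+ b) d-1) ⟩
      ((+ a) ℤ.* (+ d) ℤ.+ (+ b) ℤ.* (+ d)) / (d ℕ.* d)
    ≡⟨ cong (_/ (d ℕ.* d)) (cong₂ ℤ._+_ (ℤ.pos-* a d) (ℤ.pos-* b d)) ⟨
      frac (a ℕ.* d ℕ.+ b ℕ.* d) (d ℕ.* d) {{ℕ.m*n≢0 d d}}
    ≡⟨ frac-cross (a ℕ.* d ℕ.+ b ℕ.* d) (a ℕ.+ b) (d ℕ.* d) d {{ℕ.m*n≢0 d d}} cross ⟩
      frac (a ℕ.+ b) d ∎
    where
    open ≡-Reasoning
    cross : (a ℕ.* d ℕ.+ b ℕ.* d) ℕ.* d ≡ (a ℕ.+ b) ℕ.* (d ℕ.* d)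
    cross = trans (cong (ℕ._* d) (sym (ℕ.*-distribʳ-+ d a b))) (ℕ.*-assoc (a ℕ.+ b) d d)

  frac-zero : ∀ d .{{_ : NonZero d}} → frac 0 d ≡ 0ℚ
  frac-zero d = ℚ.0/n≡0 d

module Series where

  open Fractions
  open Counting
  open import Data.Nat as ℕ using (zero; suc; _∸_; _≤_; _<_; z≤n; s≤s; _≤?_; _≟_)
  import Data.Nat.Properties as ℕ
  open import Data.Nat.Combinatorics using (_C_)
  open import Data.Nat.Tactic.RingSolver using (solve-∀)
  open import Data.Rational using (ℚ; 0ℚ; _+_; _*_)
  import Data.Rational.Properties as ℚ
  open import Data.Empty using (⊥-elim)
  open import Data.Sum using (inj₁; inj₂)
  open import Relation.Binary.PropositionalEquality
  open import Relation.Nullary using (Dec; yes; no; ¬_)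

  overFact : ℕ → ℕ → ℚ
  overFact a n = frac a (n !) {{n !≢0}}

  overFact-zero : ∀ n → overFact 0 n ≡ 0ℚ
  overFact-zero n = frac-zero (n !) {{n !≢0}}

  when : ∀ {P : Set} → Dec P → ℕ → ℕ
  when (yes _) x = x
  when (no _)  x = 0

  when-yes : ∀ {P : Set} (d : Dec P) x → P → when d x ≡ x
  when-yes (yes _) x _ = refl
  when-yes (no ¬p) x p = ⊥-elim (¬p p)

  when-no : ∀ {P : Set} (d : Dec P) x → ¬ P → when d x ≡ 0
  when-no (yes p) x ¬p = ⊥-elim (¬p p)
  when-no (no _)  x _  = refl

  sumTo-cong : ∀ n {f g : ℕ → ℚ} → (∀ i → i ≤ n → f i ≡ g i) → sumTo n f ≡ sumTo n g
  sumTo-cong zero    f≗g = f≗g 0 z≤n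
  sumTo-cong (suc n) f≗g = cong₂ _+_ (sumTo-cong n (λ i i≤n → f≗g i (ℕ.m≤n⇒m≤1+n i≤n))) (f≗g (suc n) ℕ.≤-refl)

  sumTo-zero : ∀ n {f : ℕ → ℚ} → (∀ i → i ≤ n → f i ≡ 0ℚ) → sumTo n f ≡ 0ℚ
  sumTo-zero zero    f≗0 = f≗0 0 z≤n
  sumTo-zero (suc n) f≗0
    rewrite sumTo-zero n (λ i i≤n → f≗0 i (ℕ.m≤n⇒m≤1+n i≤n)) | f≗0 (suc n) ℕ.≤-refl = refl

  sumTo-single : ∀ n m {f : ℕ → ℚ} → m ≤ n → (∀ i → i ≤ n → i ≢ m → f i ≡ 0ℚ) → sumTo n f ≡ f m
  sumTo-single zero    zero {f} _ _ = refl
  sumTo-single (suc n) m {f} m≤1+n others with ℕ.m≤n⇒m<n∨m≡n m≤1+n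
  ... | inj₁ (s≤s m≤n)
    rewrite sumTo-single n m m≤n (λ i i≤n → others i (ℕ.m≤n⇒m≤1+n i≤n))
          | others (suc n) ℕ.≤-refl (λ 1+n≡m → ℕ.<-irrefl (sym 1+n≡m) (s≤s m≤n)) = ℚ.+-identityʳ (f m)
  ... | inj₂ refl
    rewrite sumTo-zero n (λ i i≤n → others i (ℕ.m≤n⇒m≤1+n i≤n) (λ i≡1+n → ℕ.<-irrefl i≡1+n (s≤s i≤n))) =
    ℚ.+-identityˡ (f (suc n))

  sumTo-overFact : ∀ m n (g : ℕ → ℕ) → sumTo m (λ i → overFact (g i) n) ≡ overFact (sumBelow (suc m) g) n
  sumTo-overFact zero    n g = refl
  sumTo-overFact (suc m) n g = trans (cong (_+ overFact (g (suc m)) n) (sumTo-overFact m n g))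
                                     (frac-+ (sumBelow (suc m) g) (g (suc m)) (n !) {{n !≢0}})

  -- F = (e^{zy} - 1) / y, whose coefficient of z^i y^l is [i = l + 1] / i!
  F : PS
  F = divY (subPS ezy onePS)

  F-diagonal : ∀ i → F (suc i) i ≡ overFact 1 (suc i)
  F-diagonal i with suc i ≟ suc i
  ... | yes _  = ℚ.+-identityʳ _
  ... | no i≢i = ⊥-elim (i≢i refl)

  F-off-diagonal : ∀ i l → i ≢ suc l → F i l ≡ 0ℚ
  F-off-diagonal zero    l _ = ℚ.+-identityʳ _
  F-off-diagonal (suc i) l i≢l with suc i ≟ suc l
  ... | yes i≡l = ⊥-elim (i≢l i≡l)
  ... | no  _   = ℚ.+-identityʳ _

  overFact-binomial : ∀ n i a → i ≤ n → overFact 1 i * overFact a (n ∸ i) ≡ overFact ((n C i) ℕ.* a) n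
  overFact-binomial n i a i≤n = begin
      overFact 1 i * overFact a (n ∸ i)
    ≡⟨ frac-* 1 a (i !) ((n ∸ i) !) {{i !≢0}} {{(n ∸ i) !≢0}} ⟩
      frac (1 ℕ.* a) (i ! ℕ.* (n ∸ i) !) {{ℕ.m*n≢0 (i !) ((n ∸ i) !) {{i !≢0}} {{(n ∸ i) !≢0}}}}
    ≡⟨ frac-cross (1 ℕ.* a) ((n C i) ℕ.* a) (i ! ℕ.* (n ∸ i) !) (n !)
         {{ℕ.m*n≢0 (i !) ((n ∸ i) !) {{i !≢0}} {{(n ∸ i) !≢0}}}} {{n !≢0}} cross ⟩
      overFact ((n C i) ℕ.* a) n ∎
    where
    open ≡-Reasoning
    cross : (1 ℕ.* a) ℕ.* n ! ≡ ((n C i) ℕ.* a) ℕ.* (i ! ℕ.* (n ∸ i) !)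
    cross rewrite sym (binomial-factorials n i i≤n) = regroup a (n C i) (i ! ℕ.* (n ∸ i) !)
      where regroup : ∀ a c p → (1 ℕ.* a) ℕ.* (c ℕ.* p) ≡ (c ℕ.* a) ℕ.* p
            regroup = solve-∀

  overFact-divide : ∀ n j s → overFact (j ! ℕ.* s) n * overFact 1 j ≡ overFact s n
  overFact-divide n j s = begin
      overFact (j ! ℕ.* s) n * overFact 1 j
    ≡⟨ frac-* (j ! ℕ.* s) 1 (n !) (j !) {{n !≢0}} {{j !≢0}} ⟩
      frac (j ! ℕ.* s ℕ.* 1) (n ! ℕ.* j !) {{ℕ.m*n≢0 (n !) (j !) {{n !≢0}} {{j !≢0}}}}
    ≡⟨ frac-cross (j ! ℕ.* s ℕ.* 1) s (n ! ℕ.* j !) (n !)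
         {{ℕ.m*n≢0 (n !) (j !) {{n !≢0}} {{j !≢0}}}} {{n !≢0}} (regroup (j !) s (n !)) ⟩
      overFact s n ∎
    where
    open ≡-Reasoning
    regroup : ∀ f s m → (f ℕ.* s ℕ.* 1) ℕ.* m ≡ s ℕ.* (m ℕ.* f)
    regroup = solve-∀

  -- numerator (over n!) of the coefficient of z^n y^k in F^j: F^j is
  -- homogeneous, supported on n = k + j, with coefficient surj j n / n!
  powerNumerator : ℕ → ℕ → ℕ → ℕ
  powerNumerator j n k = when (k ℕ.+ j ≟ n) (surj j n)

  -- bookkeeping of degrees in the product F · F^j, whose row i (the
  -- z-degree taken from F) uses the coefficient of F^j at (n-i-1, k-i)
  degrees-match : ∀ i k j n → i ≤ k → k ℕ.+ suc j ≡ n → (k ∸ i) ℕ.+ j ≡ n ∸ suc i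
  degrees-match i k j n i≤k refl rewrite ℕ.+-suc k j = sym (ℕ.+-∸-comm j i≤k)

  degrees-match⁻ : ∀ i k j n → i ≤ k → i < n → (k ∸ i) ℕ.+ j ≡ n ∸ suc i → k ℕ.+ suc j ≡ n
  degrees-match⁻ i k j n i≤k i<n eq = begin
      k ℕ.+ suc j                ≡⟨ cong (ℕ._+ suc j) (ℕ.m∸n+n≡m i≤k) ⟨
      (k ∸ i) ℕ.+ i ℕ.+ suc j    ≡⟨ regroup (k ∸ i) i j ⟩
      ((k ∸ i) ℕ.+ j) ℕ.+ suc i  ≡⟨ cong (ℕ._+ suc i) eq ⟩
      (n ∸ suc i) ℕ.+ suc i      ≡⟨ ℕ.m∸n+n≡m i<n ⟩
      n                          ∎
    where open ≡-Reasoning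
          regroup : ∀ a i j → a ℕ.+ i ℕ.+ suc j ≡ (a ℕ.+ j) ℕ.+ suc i
          regroup = solve-∀

  degrees-exceed : ∀ i k j n → k < i → i < n → k ℕ.+ suc j ≡ n → n ∸ suc i < j
  degrees-exceed i k j n k<i i<n eq = ℕ.+-cancelʳ-< (suc i) (n ∸ suc i) j (begin-strict
      (n ∸ suc i) ℕ.+ suc i  ≡⟨ ℕ.m∸n+n≡m i<n ⟩
      n                      ≡⟨ eq ⟨
      k ℕ.+ suc j            ≡⟨ ℕ.+-comm k (suc j) ⟩
      suc j ℕ.+ k            <⟨ ℕ.+-monoʳ-< (suc j) k<i ⟩
      suc j ℕ.+ i            ≡⟨ ℕ.+-suc j i ⟨
      j ℕ.+ suc i            ∎)
    where open ℕ.≤-Reasoning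

  -- numerator of row i of F · F^j (row 0 vanishes since F has no z^0 term)
  rowNumerator : ℕ → ℕ → ℕ → ℕ → ℕ
  rowNumerator j n k zero    = 0
  rowNumerator j n k (suc i) = when (i ≤? k) ((n C suc i) ℕ.* powerNumerator j (n ∸ suc i) (k ∸ i))

  -- the rows add up to the numerator of F^(j+1): this is the defining
  -- convolution of surj, with the degree conditions checked row by row
  rows-sum : ∀ j n k → sumBelow (suc n) (rowNumerator j n k) ≡ powerNumerator (suc j) n k
  rows-sum j n k = trans (sumBelow-first n (rowNumerator j n k)) (by-degree (k ℕ.+ suc j ≟ n))
    where
    by-degree : (d : Dec (k ℕ.+ suc j ≡ n)) →
                sumBelow n (λ i → rowNumerator j n k (suc i)) ≡ when d (surj (suc j) n)
    by-degree (yes deg) = sumBelow-cong n row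
      where
      row : ∀ i → i < n → rowNumerator j n k (suc i) ≡ (n C suc i) ℕ.* surj j (n ∸ suc i)
      row i i<n with i ≤? k
      ... | yes i≤k = cong ((n C suc i) ℕ.*_)
              (when-yes ((k ∸ i) ℕ.+ j ≟ n ∸ suc i) _ (degrees-match i k j n i≤k deg))
      ... | no  i≰k = sym (trans (cong ((n C suc i) ℕ.*_)
              (surj-vanish j (n ∸ suc i) (degrees-exceed i k j n (ℕ.≰⇒> i≰k) i<n deg)))
              (ℕ.*-zeroʳ (n C suc i)))
    by-degree (no ¬deg) = sumBelow-zero n row
      where
      row : ∀ i → i < n → rowNumerator j n k (suc i) ≡ 0
      row i i<n with i ≤? k
      ... | yes i≤k = trans (cong ((n C suc i) ℕ.*_)
              (when-no ((k ∸ i) ℕ.+ j ≟ n ∸ suc i) _ (λ eq → ¬deg (degrees-match⁻ i k j n i≤k i<n eq))))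
              (ℕ.*-zeroʳ (n C suc i))
      ... | no  _   = refl

  powPS-F : ∀ j n k → powPS F j n k ≡ overFact (powerNumerator j n k) n
  powPS-F zero zero    zero    = refl
  powPS-F zero zero    (suc k) = sym (overFact-zero 0)
  powPS-F zero (suc n) k with k ℕ.+ 0 ≟ suc n
  ... | yes _ = sym (overFact-zero (suc n))
  ... | no  _ = sym (overFact-zero (suc n))
  powPS-F (suc j) n k = begin
      sumTo n (λ i → sumTo k (λ l → F i l * powPS F j (n ∸ i) (k ∸ l)))
    ≡⟨ sumTo-cong n row ⟩
      sumTo n (λ i → overFact (rowNumerator j n k i) n)
    ≡⟨ sumTo-overFact n n (rowNumerator j n k) ⟩
      overFact (sumBelow (suc n) (rowNumerator j n k)) n
    ≡⟨ cong (λ a → overFact a n) (rows-sum j n k) ⟩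
      overFact (powerNumerator (suc j) n k) n ∎
    where
    open ≡-Reasoning
    vanishes : ∀ i l → i ≢ suc l → F i l * powPS F j (n ∸ i) (k ∸ l) ≡ 0ℚ
    vanishes i l i≢l = trans (cong (_* powPS F j (n ∸ i) (k ∸ l)) (F-off-diagonal i l i≢l)) (ℚ.*-zeroˡ (powPS F j (n ∸ i) (k ∸ l)))
    -- in row i+1 only the summand l = i survives
    row : ∀ i → i ≤ n → sumTo k (λ l → F i l * powPS F j (n ∸ i) (k ∸ l)) ≡ overFact (rowNumerator j n k i) n
    row zero    _ = trans (sumTo-zero k (λ l _ → vanishes 0 l (λ ()))) (sym (overFact-zero n))
    row (suc i) i<n with i ≤? k
    ... | yes i≤k = begin
        sumTo k (λ l → F (suc i) l * powPS F j (n ∸ suc i) (k ∸ l))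
      ≡⟨ sumTo-single k i i≤k (λ l _ l≢i → vanishes (suc i) l (λ eq → l≢i (sym (ℕ.suc-injective eq)))) ⟩
        F (suc i) i * powPS F j (n ∸ suc i) (k ∸ i)
      ≡⟨ cong₂ _*_ (F-diagonal i) (powPS-F j (n ∸ suc i) (k ∸ i)) ⟩
        overFact 1 (suc i) * overFact (powerNumerator j (n ∸ suc i) (k ∸ i)) (n ∸ suc i)
      ≡⟨ overFact-binomial n (suc i) _ i<n ⟩
        overFact ((n C suc i) ℕ.* powerNumerator j (n ∸ suc i) (k ∸ i)) n ∎
    ... | no  i≰k = trans (sumTo-zero k (λ l l≤k → vanishes (suc i) l (λ eq → i≰k (subst (_≤ k) (sym (ℕ.suc-injective eq)) l≤k))))
                          (sym (overFact-zero n))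

  -- the coefficient of z^n y^k in e^F is the t-shelf count divided by n!:
  -- only the term F^(n-k) / (n-k)! contributes
  targetPS-coefficient : ∀ n k → targetPS n k ≡ overFact (shelfCount n k) n
  targetPS-coefficient n k with k ℕ.≤? n
  ... | yes k≤n = begin
      sumTo n (λ j → powPS F j n k * invFact j)
    ≡⟨ sumTo-single n (n ∸ k) (ℕ.m∸n≤m n k) (λ j _ j≢ → term-vanishes j (λ eq → j≢ (sym (blocks eq)))) ⟩
      powPS F (n ∸ k) n k * overFact 1 (n ∸ k)
    ≡⟨ cong (_* overFact 1 (n ∸ k)) (powPS-F (n ∸ k) n k) ⟩
      overFact (when (k ℕ.+ (n ∸ k) ≟ n) (surj (n ∸ k) n)) n * overFact 1 (n ∸ k)
    ≡⟨ cong (λ a → overFact a n * overFact 1 (n ∸ k)) (when-yes (k ℕ.+ (n ∸ k) ≟ n) _ (ℕ.m+[n∸m]≡n k≤n)) ⟩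
      overFact (surj (n ∸ k) n) n * overFact 1 (n ∸ k)
    ≡⟨ cong (λ a → overFact a n * overFact 1 (n ∸ k)) (surj≡j!*stirling (n ∸ k) n) ⟩
      overFact ((n ∸ k) ! ℕ.* stirling n (n ∸ k)) n * overFact 1 (n ∸ k)
    ≡⟨ overFact-divide n (n ∸ k) (stirling n (n ∸ k)) ⟩
      overFact (stirling n (n ∸ k)) n
    ≡⟨ cong (λ a → overFact a n) (shelfCount≡stirling n k k≤n) ⟨
      overFact (shelfCount n k) n ∎
    where
    open ≡-Reasoning
    blocks : ∀ {j} → k ℕ.+ j ≡ n → n ∸ k ≡ j
    blocks {j} eq = trans (cong (_∸ k) (sym eq)) (ℕ.m+n∸m≡n k j)
    term-vanishes : ∀ j → k ℕ.+ j ≢ n → powPS F j n k * invFact j ≡ 0ℚ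
    term-vanishes j ¬deg = trans (cong (_* invFact j)
      (trans (powPS-F j n k) (trans (cong (λ a → overFact a n) (when-no (k ℕ.+ j ≟ n) _ ¬deg)) (overFact-zero n))))
      (ℚ.*-zeroˡ (invFact j))
  ... | no k≰n = trans (sumTo-zero n (λ j _ → term-vanishes j))
                       (sym (trans (cong (λ a → overFact a n) (shelfCount-vanish n k (ℕ.≰⇒> k≰n))) (overFact-zero n)))
    where
    term-vanishes : ∀ j → powPS F j n k * invFact j ≡ 0ℚ
    term-vanishes j = trans (cong (_* invFact j)
      (trans (powPS-F j n k) (trans (cong (λ a → overFact a n)
        (when-no (k ℕ.+ j ≟ n) _ (λ eq → k≰n (subst (k ≤_) eq (ℕ.m≤m+n k j))))) (overFact-zero n))))
      (ℚ.*-zeroˡ (invFact j))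

module ListFacts where

  open import Data.Nat using (ℕ; _+_; _*_)
  open import Data.Nat.Properties using (*-zeroʳ; *-suc)
  open import Data.List using (List; []; _∷_; map; concatMap; length)
  open import Data.List.Properties using (length-++)
  open import Data.List.Membership.Propositional using (_∈_; find)
  open import Data.List.Relation.Unary.Any using (here; there)
  import Data.List.Relation.Unary.All as All
  import Data.List.Relation.Unary.All.Properties as All
  open import Data.List.Relation.Unary.AllPairs using ([]; _∷_)
  open import Data.List.Relation.Unary.Unique.Propositional using (Unique)
  import Data.List.Relation.Unary.Unique.Propositional.Properties as Unique
  open import Data.List.Membership.Propositional.Properties using (∈-concatMap⁻)
  open import Data.Product using (_,_; _×_)
  open import Data.List.Membership.Propositional.Properties.WithK using (unique∧set⇒bag)
  open import Data.List.Relation.Binary.BagAndSetEquality using (∼bag⇒↭)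
  open import Data.List.Relation.Binary.Permutation.Propositional.Properties using (↭-length)
  open import Function.Bundles using (_⇔_)
  open import Relation.Nullary using (¬_)
  open import Relation.Binary.PropositionalEquality using (_≡_; refl; sym; cong₂; trans)

  same-length : {A : Set} {xs ys : List A} → Unique xs → Unique ys → (∀ x → (x ∈ xs) ⇔ (x ∈ ys)) →
                length xs ≡ length ys
  same-length xs! ys! same = ↭-length (∼bag⇒↭ (unique∧set⇒bag xs! ys! (λ {x} → same x)))

  module _ {A B : Set} where

    unique-map : (f : A → B) {xs : List A} → Unique xs →
                 (∀ {x y} → x ∈ xs → y ∈ xs → f x ≡ f y → x ≡ y) → Unique (map f xs)
    unique-map f {[]}     []          _   = []
    unique-map f {x ∷ xs} (x∉xs ∷ xs!) inj =
      All.map⁺ (All.tabulate (λ y∈xs fx≡fy → All.lookup x∉xs y∈xs (inj (here refl) (there y∈xs) fx≡fy)))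
      ∷ unique-map f xs! (λ x∈ y∈ → inj (there x∈) (there y∈))

    unique-concatMap : (f : A → List B) {xs : List A} → Unique xs →
                       (∀ {x} → x ∈ xs → Unique (f x)) →
                       (∀ {x y z} → x ∈ xs → y ∈ xs → z ∈ f x → z ∈ f y → x ≡ y) →
                       Unique (concatMap f xs)
    unique-concatMap f {[]}     []          _      _        = []
    unique-concatMap f {x ∷ xs} (x∉xs ∷ xs!) blocks! disjoint =
      Unique.++⁺ (blocks! (here refl))
                 (unique-concatMap f xs! (λ y∈ → blocks! (there y∈)) (λ y∈ y'∈ → disjoint (there y∈) (there y'∈)))
                 separate
      where
      separate : ∀ {z} → ¬ (z ∈ f x × z ∈ concatMap f xs)
      separate (z∈fx , z∈rest) with find (∈-concatMap⁻ f {xs} z∈rest)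
      ... | y , y∈xs , z∈fy = All.lookup x∉xs y∈xs (disjoint (here refl) (there y∈xs) z∈fx z∈fy)

    length-concatMap : (f : A → List B) (c : ℕ) (xs : List A) →
                       (∀ {x} → x ∈ xs → length (f x) ≡ c) → length (concatMap f xs) ≡ c * length xs
    length-concatMap f c []       _   = sym (*-zeroʳ c)
    length-concatMap f c (x ∷ xs) len =
      trans (length-++ (f x))
        (trans (cong₂ _+_ (len (here refl)) (length-concatMap f c xs (λ y∈ → len (there y∈))))
               (sym (*-suc c (length xs))))

module Insertion where

  open import Data.Nat using (ℕ; zero; suc; _+_; _≤_; _<_; z≤n; s≤s)
  import Data.Nat.Properties as ℕ
  open import Data.List using (_∷_; _++_)
  open import Data.List.Membership.Propositional using (_∈_; _∉_)
  open import Data.List.Membership.Propositional.Properties using (∈-++⁺ˡ; ∈-++⁻)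
  open import Data.List.Relation.Unary.Any using (here; there)
  open import Data.List.Relation.Unary.All as All using (All; _∷_)
  import Data.List.Relation.Unary.All.Properties as All
  open import Data.List.Relation.Binary.Permutation.Propositional using (_↭_; ↭-refl; ↭-trans; ↭-prep; ↭-swap)
  open import Data.List.Relation.Binary.Permutation.Propositional.Properties using (++⁺ˡ; ++⁺ʳ; shift)
  open import Data.Unit using (tt)
  open import Data.Product using (_×_; _,_; ∃; ∃₂)
  open import Data.Sum using (inj₁; inj₂)
  open import Data.Empty using (⊥-elim)
  open import Relation.Binary.PropositionalEquality

  -- length of the right spine: in an avoiding t-shelf the spine nodes are
  -- the minima of the blocks, each block being a spine node with its
  -- chain of left children
  spine : Tree → ℕ
  spine leaf         = 0
  spine (node _ _ r) = suc (spine r)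

  appendLeft : ℕ → Tree → Tree
  appendLeft a leaf         = node a leaf leaf
  appendLeft a (node b l r) = node b (appendLeft a l) r

  -- insert a into the block of the i-th spine node, or as a new block at
  -- the end of the spine when i = spine t
  insert : ℕ → ℕ → Tree → Tree
  insert a zero    t            = appendLeft a t
  insert a (suc i) leaf         = node a leaf leaf
  insert a (suc i) (node b l r) = node b l (insert a i r)

  Below : ℕ → Tree → Set
  Below a t = All (_< a) (labels t)

  below-left : ∀ {a b l r} → Below a (node b l r) → Below a l
  below-left {l = l} (_ ∷ below) = All.++⁻ˡ (labels l) below

  below-right : ∀ {a b l r} → Below a (node b l r) → Below a r
  below-right {l = l} (_ ∷ below) = All.++⁻ʳ (labels l) below

  below-∉ : ∀ {a t} → Below a t → a ∉ labels t
  below-∉ below a∈t = ℕ.<-irrefl refl (All.lookup below a∈t)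

  labels-appendLeft : ∀ a t → labels (appendLeft a t) ↭ a ∷ labels t
  labels-appendLeft a leaf         = ↭-refl
  labels-appendLeft a (node b l r) = ↭-trans (↭-prep b (++⁺ʳ (labels r) (labels-appendLeft a l))) (↭-swap b a ↭-refl)

  labels-insert : ∀ a i t → labels (insert a i t) ↭ a ∷ labels t
  labels-insert a zero    t            = labels-appendLeft a t
  labels-insert a (suc i) leaf         = ↭-refl
  labels-insert a (suc i) (node b l r) =
    ↭-trans (↭-prep b (↭-trans (++⁺ˡ (labels l) (labels-insert a i r)) (shift a (labels l) (labels r))))
            (↭-swap b a ↭-refl)

  ∈-appendLeft : ∀ a t → a ∈ labels (appendLeft a t)
  ∈-appendLeft a leaf         = here refl
  ∈-appendLeft a (node b l r) = there (∈-++⁺ˡ (∈-appendLeft a l))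

  above-appendLeft : ∀ {a b} t → b < a → Above b t → Above b (appendLeft a t)
  above-appendLeft leaf         b<a _ = b<a
  above-appendLeft (node _ _ _) _   p = p

  above-appendLeft⁻ : ∀ {a b} t → Above b (appendLeft a t) → Above b t
  above-appendLeft⁻ leaf         _ = tt
  above-appendLeft⁻ (node _ _ _) p = p

  above-insert : ∀ {a b} i t → b < a → Above b t → Above b (insert a i t)
  above-insert zero    t            b<a p = above-appendLeft t b<a p
  above-insert (suc i) leaf         b<a _ = b<a
  above-insert (suc i) (node _ _ _) _   p = p

  above-insert⁻ : ∀ {a b} i t → Above b (insert a i t) → Above b t
  above-insert⁻ zero    t            p = above-appendLeft⁻ t p
  above-insert⁻ (suc i) leaf         _ = tt
  above-insert⁻ (suc i) (node _ _ _) p = p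

  increasing-appendLeft : ∀ a t → Below a t → Increasing t → Increasing (appendLeft a t)
  increasing-appendLeft a leaf         _     _                    = tt , tt , tt , tt
  increasing-appendLeft a (node b l r) below (al , ar , il , ir) =
    above-appendLeft l (All.head below) al , ar , increasing-appendLeft a l (below-left below) il , ir

  increasing-appendLeft⁻ : ∀ a t → Increasing (appendLeft a t) → Increasing t
  increasing-appendLeft⁻ a leaf         _                    = tt
  increasing-appendLeft⁻ a (node b l r) (al , ar , il , ir) =
    above-appendLeft⁻ l al , ar , increasing-appendLeft⁻ a l il , ir

  increasing-insert : ∀ a i t → Below a t → Increasing t → Increasing (insert a i t)
  increasing-insert a zero    t            below inc                  = increasing-appendLeft a t below inc
  increasing-insert a (suc i) leaf         _     _                    = tt , tt , tt , tt
  increasing-insert a (suc i) (node b l r) below (al , ar , il , ir) =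
    al , above-insert i r (All.head below) ar , il , increasing-insert a i r (below-right below) ir

  increasing-insert⁻ : ∀ a i t → Increasing (insert a i t) → Increasing t
  increasing-insert⁻ a zero    t            inc                  = increasing-appendLeft⁻ a t inc
  increasing-insert⁻ a (suc i) leaf         _                    = tt
  increasing-insert⁻ a (suc i) (node b l r) (al , ar , il , ir) =
    al , above-insert⁻ i r ar , il , increasing-insert⁻ a i r ir

  -- appending to a left chain never creates a right child below a left
  -- child, so insertion preserves and reflects avoidance of P

  noRightChild-appendLeft : ∀ a t → NoRightChild t → NoRightChild (appendLeft a t)
  noRightChild-appendLeft a leaf         _ = refl
  noRightChild-appendLeft a (node _ _ _) p = p

  noRightChild-appendLeft⁻ : ∀ a t → NoRightChild (appendLeft a t) → NoRightChild t
  noRightChild-appendLeft⁻ a leaf         _ = tt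
  noRightChild-appendLeft⁻ a (node _ _ _) p = p

  avoids-appendLeft : ∀ a t → AvoidsP t → AvoidsP (appendLeft a t)
  avoids-appendLeft a leaf         _              = tt , tt , tt
  avoids-appendLeft a (node b l r) (nr , al , ar) = noRightChild-appendLeft a l nr , avoids-appendLeft a l al , ar

  avoids-appendLeft⁻ : ∀ a t → AvoidsP (appendLeft a t) → AvoidsP t
  avoids-appendLeft⁻ a leaf         _              = tt
  avoids-appendLeft⁻ a (node b l r) (nr , al , ar) = noRightChild-appendLeft⁻ a l nr , avoids-appendLeft⁻ a l al , ar

  avoids-insert : ∀ a i t → AvoidsP t → AvoidsP (insert a i t)
  avoids-insert a zero    t            av             = avoids-appendLeft a t av
  avoids-insert a (suc i) leaf         _              = tt , tt , tt
  avoids-insert a (suc i) (node b l r) (nr , al , ar) = nr , al , avoids-insert a i r ar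

  avoids-insert⁻ : ∀ a i t → AvoidsP (insert a i t) → AvoidsP t
  avoids-insert⁻ a zero    t            av             = avoids-appendLeft⁻ a t av
  avoids-insert⁻ a (suc i) leaf         _              = tt
  avoids-insert⁻ a (suc i) (node b l r) (nr , al , ar) = nr , al , avoids-insert⁻ a i r ar

  leftChildren-appendLeft : ∀ a t →
    nonEmpty (appendLeft a t) + leftChildren (appendLeft a t) ≡ suc (nonEmpty t + leftChildren t)
  leftChildren-appendLeft a leaf = refl
  leftChildren-appendLeft a (node b l r) rewrite leftChildren-appendLeft a l = refl

  leftChildren-join : ∀ a i t → i < spine t → leftChildren (insert a i t) ≡ suc (leftChildren t)
  leftChildren-join a zero    (node b l r) _ rewrite leftChildren-appendLeft a l = refl
  leftChildren-join a (suc i) (node b l r) (s≤s i<spine)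
    rewrite leftChildren-join a i r i<spine = ℕ.+-suc (nonEmpty l + leftChildren l) (leftChildren r)

  leftChildren-newBlock : ∀ a t → leftChildren (insert a (spine t) t) ≡ leftChildren t
  leftChildren-newBlock a leaf         = refl
  leftChildren-newBlock a (node b l r) = cong (λ m → nonEmpty l + leftChildren l + m) (leftChildren-newBlock a r)

  spine-join : ∀ a i t → i < spine t → spine (insert a i t) ≡ spine t
  spine-join a zero    (node b l r) _             = refl
  spine-join a (suc i) (node b l r) (s≤s i<spine) = cong suc (spine-join a i r i<spine)

  spine-newBlock : ∀ a t → spine (insert a (spine t) t) ≡ suc (spine t)
  spine-newBlock a leaf         = refl
  spine-newBlock a (node b l r) = cong suc (spine-newBlock a r)

  node-injective : ∀ {b b' l l' r r'} → node b l r ≡ node b' l' r' → b ≡ b' × l ≡ l' × r ≡ r'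
  node-injective refl = refl , refl , refl

  appendLeft≢leaf : ∀ a t → appendLeft a t ≢ leaf
  appendLeft≢leaf a leaf         ()
  appendLeft≢leaf a (node _ _ _) ()

  appendLeft-injective : ∀ a t t' → appendLeft a t ≡ appendLeft a t' → t ≡ t'
  appendLeft-injective a leaf         leaf           _  = refl
  appendLeft-injective a leaf         (node _ l' _)  eq with node-injective eq
  ... | _ , leaf≡l' , _ = ⊥-elim (appendLeft≢leaf a l' (sym leaf≡l'))
  appendLeft-injective a (node _ l _) leaf           eq with node-injective eq
  ... | _ , l≡leaf , _  = ⊥-elim (appendLeft≢leaf a l l≡leaf)
  appendLeft-injective a (node b l r) (node b' l' r') eq with node-injective eq
  ... | refl , eq-l , refl = cong (λ l → node b l r) (appendLeft-injective a l l' eq-l)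

  -- a joining the root block never gives the same tree as a joining a
  -- later block, since a would have to lie in the left subtree of t'
  root≢later : ∀ {a b' l' r'} t j → Below a (node b' l' r') →
               appendLeft a t ≢ node b' l' (insert a j r')
  root≢later leaf         j below eq with node-injective eq
  ... | refl , _ , _ = ℕ.<-irrefl refl (All.head below)
  root≢later (node b l r) j below eq with node-injective eq
  ... | _ , refl , _ = below-∉ (below-left below) (∈-appendLeft _ l)

  insert-injective : ∀ {a} i j t t' → Below a t → Below a t' → i ≤ spine t → j ≤ spine t' →
                     insert a i t ≡ insert a j t' → i ≡ j × t ≡ t'
  insert-injective zero    zero    t t' _ _ _ _ eq = refl , appendLeft-injective _ t t' eq
  insert-injective zero    (suc j) t (node _ _ _) _ below' _ _ eq = ⊥-elim (root≢later t j below' eq)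
  insert-injective (suc i) zero    (node _ _ _) t' below _ _ _ eq = ⊥-elim (root≢later t' i below (sym eq))
  insert-injective (suc i) (suc j) (node b l r) (node b' l' r') below below' (s≤s i≤) (s≤s j≤) eq
    with node-injective eq
  ... | refl , refl , eq-r with insert-injective i j r r' (below-right below) (below-right below') i≤ j≤ eq-r
  ... | refl , refl = refl , refl

  above-max : ∀ {a} t → Above a t → All (_≤ a) (labels t) → t ≡ leaf
  above-max leaf         _   _           = refl
  above-max (node _ _ _) a<d (d≤a ∷ _) = ⊥-elim (ℕ.<⇒≱ a<d d≤a)

  chain-max : ∀ a t → Increasing t → NoRightChild t → AvoidsP t → a ∈ labels t →
              All (_≤ a) (labels t) → ∃ λ t' → t ≡ appendLeft a t'
  chain-max a (node c l leaf) (al , _) refl _ (here refl) (_ ∷ max)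
    rewrite above-max l al (All.++⁻ˡ (labels l) max) = leaf , refl
  chain-max a (node c l leaf) (_ , _ , il , _) refl (nr , av , _) (there a∈) (_ ∷ max)
    with ∈-++⁻ (labels l) a∈
  ... | inj₁ a∈l with chain-max a l il nr av a∈l (All.++⁻ˡ (labels l) max)
  ...   | l' , refl = node c l' leaf , refl
  chain-max a (node c l leaf) _ refl _ (there a∈) _ | inj₂ ()

  max-decomposition : ∀ a t → Increasing t → AvoidsP t → a ∈ labels t → All (_≤ a) (labels t) →
                      ∃₂ λ i t' → i ≤ spine t' × t ≡ insert a i t'
  max-decomposition a (node a l r) (al , ar , _) _ (here refl) (_ ∷ max)
    rewrite above-max l al (All.++⁻ˡ (labels l) max) | above-max r ar (All.++⁻ʳ (labels l) max) =
    0 , leaf , z≤n , refl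
  max-decomposition a (node b l r) (_ , _ , il , ir) (nr , av , avr) (there a∈) (_ ∷ max)
    with ∈-++⁻ (labels l) a∈
  ... | inj₁ a∈l with chain-max a l il nr av a∈l (All.++⁻ˡ (labels l) max)
  ...   | l' , refl = 0 , node b l' r , z≤n , refl
  max-decomposition a (node b l r) (_ , _ , il , ir) (nr , av , avr) (there a∈) (_ ∷ max)
      | inj₂ a∈r with max-decomposition a r ir avr a∈r (All.++⁻ʳ (labels l) max)
  ...   | i , r' , i≤ , refl = suc i , node b l r' , s≤s i≤ , refl

module Enumeration where

  open Insertion
  open ListFacts
  open Counting using (shelfCount)
  open import Data.Nat using (ℕ; zero; suc; _+_; _∸_; _≤_; _<_; s≤s)
  import Data.Nat.Properties as ℕ
  open import Data.List using (List; []; _∷_; _++_; map; concatMap; upTo; applyUpTo; length)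
  import Data.List.Properties as List
  open import Data.List.Membership.Propositional using (_∈_; find; lose)
  open import Data.List.Membership.Propositional.Properties
    using (∈-map⁺; ∈-map⁻; ∈-++⁺ˡ; ∈-++⁺ʳ; ∈-++⁻; ∈-upTo⁺; ∈-upTo⁻; ∈-concatMap⁺; ∈-concatMap⁻; ∈-applyUpTo⁻)
  open import Data.List.Relation.Unary.Any using (here)
  open import Data.List.Relation.Unary.All as All using (All; [])
  open import Data.List.Relation.Unary.AllPairs using ([]; _∷_)
  open import Data.List.Relation.Unary.Unique.Propositional using (Unique)
  import Data.List.Relation.Unary.Unique.Propositional.Properties as Unique
  open import Data.List.Relation.Binary.Permutation.Propositional using (_↭_; ↭-refl; ↭-trans; ↭-sym; ↭-prep)
  open import Data.List.Relation.Binary.Permutation.Propositional.Properties using (∷↭∷ʳ; drop-∷; ↭-empty-inv; ∈-resp-↭)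
  open import Data.Unit using (tt)
  open import Data.Product using (_×_; _,_; ∃; proj₁; proj₂)
  open import Data.Sum using (inj₁; inj₂)
  open import Relation.Nullary using (¬_)
  open import Function.Bundles using (_⇔_; mk⇔)
  open import Relation.Binary.PropositionalEquality

  Shelf : ℕ → ℕ → Tree → Set
  Shelf n k t = IsTShelf n t × AvoidsP t × leftChildren t ≡ k

  shelf-with : ∀ {n k t} → IsTShelf n t × AvoidsP t → leftChildren t ≡ k → Shelf n k t
  shelf-with (shelf , av) lc = shelf , av , lc

  labels-step : ∀ n → applyUpTo suc (suc n) ↭ suc n ∷ applyUpTo suc n
  labels-step n = subst (_↭ suc n ∷ applyUpTo suc n) (List.applyUpTo-∷ʳ suc n)
                        (↭-sym (∷↭∷ʳ (suc n) (applyUpTo suc n)))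

  below-size : ∀ {n t} → labels t ↭ applyUpTo suc n → Below (suc n) t
  below-size perm = All.tabulate (λ x∈t → bound (∈-applyUpTo⁻ suc (∈-resp-↭ perm x∈t)))
    where bound : ∀ {n x} → ∃ (λ i → i < n × x ≡ suc i) → x < suc n
          bound (i , i<n , refl) = s≤s i<n

  insert-shelf : ∀ {n t} i → IsTShelf n t → AvoidsP t →
                 IsTShelf (suc n) (insert (suc n) i t) × AvoidsP (insert (suc n) i t)
  insert-shelf {n} {t} i (inc , perm) av =
    (increasing-insert (suc n) i t (below-size perm) inc ,
     ↭-trans (labels-insert (suc n) i t) (↭-trans (↭-prep (suc n) perm) (↭-sym (labels-step n)))) ,
    avoids-insert (suc n) i t av

  insert-shelf⁻ : ∀ {n t} i → IsTShelf (suc n) (insert (suc n) i t) → AvoidsP (insert (suc n) i t) →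
                  IsTShelf n t × AvoidsP t
  insert-shelf⁻ {n} {t} i (inc , perm) av =
    (increasing-insert⁻ (suc n) i t inc ,
     drop-∷ (↭-trans (↭-sym (labels-insert (suc n) i t)) (↭-trans perm (labels-step n)))) ,
    avoids-insert⁻ (suc n) i t av

  newBlock : ℕ → Tree → Tree
  newBlock a t = insert a (spine t) t

  joins : ℕ → Tree → List Tree
  joins a t = map (λ i → insert a i t) (upTo (spine t))

  shelves : ℕ → ℕ → List Tree
  joined  : ℕ → ℕ → List Tree

  shelves zero    zero    = leaf ∷ []
  shelves zero    (suc k) = []
  shelves (suc n) k       = map (newBlock (suc n)) (shelves n k) ++ joined n k

  joined n zero    = []
  joined n (suc k) = concatMap (joins (suc n)) (shelves n k)

  data Joined (n : ℕ) : ℕ → Tree → Set where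
    joined-at : ∀ {k t i} → t ∈ shelves n k → i < spine t → Joined n (suc k) (insert (suc n) i t)

  ∈-joined⁻ : ∀ {n k t} → t ∈ joined n k → Joined n k t
  ∈-joined⁻ {n} {suc k} t∈ with find (∈-concatMap⁻ (joins (suc n)) {shelves n k} t∈)
  ... | t' , t'∈ , t∈joins with ∈-map⁻ (λ i → insert (suc n) i t') t∈joins
  ...   | i , i∈ , refl = joined-at t'∈ (∈-upTo⁻ i∈)

  ∈-joined⁺ : ∀ {n k t} → Joined n k t → t ∈ joined n k
  ∈-joined⁺ {n} (joined-at {t = t} t∈ i<spine) =
    ∈-concatMap⁺ (joins (suc n)) (lose t∈ (∈-map⁺ (λ i → insert (suc n) i t) (∈-upTo⁺ i<spine)))

  sound : ∀ n k t → t ∈ shelves n k → Shelf n k t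
  sound zero    zero t (here refl) = (tt , ↭-refl) , tt , refl
  sound (suc n) k  t t∈ with ∈-++⁻ (map (newBlock (suc n)) (shelves n k)) t∈
  ... | inj₁ t∈opened with ∈-map⁻ (newBlock (suc n)) t∈opened
  ...   | t' , t'∈ , refl with sound n k t' t'∈
  ...     | shelf , av , lc = shelf-with (insert-shelf (spine t') shelf av) (trans (leftChildren-newBlock (suc n) t') lc)
  sound (suc n) k t t∈ | inj₂ t∈joined with ∈-joined⁻ {n} {k} t∈joined
  ... | joined-at {t = t'} {i} t'∈ i<spine with sound n _ t' t'∈
  ...   | shelf , av , lc = shelf-with (insert-shelf i shelf av) (trans (leftChildren-join (suc n) i t' i<spine) (cong suc lc))

  below-listed : ∀ {n k t} → t ∈ shelves n k → Below (suc n) t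
  below-listed {n} {k} {t} t∈ = below-size (proj₂ (proj₁ (sound n k t t∈)))

  -- every avoiding t-shelf is listed: remove its largest label
  complete : ∀ n k t → Shelf n k t → t ∈ shelves n k
  complete zero    k leaf         (_ , _ , refl) = here refl
  complete zero    k (node _ _ _) ((_ , perm) , _) with ↭-empty-inv perm
  ... | ()
  complete (suc n) k t ((inc , perm) , av , lc)
    with max-decomposition (suc n) t inc av max∈ max-bound
    where
    max∈ : suc n ∈ labels t
    max∈ = ∈-resp-↭ (↭-sym (↭-trans perm (labels-step n))) (here refl)
    max-bound : All (_≤ suc n) (labels t)
    max-bound = All.map ℕ.≤-pred (below-size perm)
  ... | i , t' , i≤spine , refl with insert-shelf⁻ i (inc , perm) av | ℕ.m≤n⇒m<n∨m≡n i≤spine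
  ...   | shelf' , av' | inj₂ refl = ∈-++⁺ˡ (∈-map⁺ (newBlock (suc n))
            (complete n k t' (shelf' , av' , trans (sym (leftChildren-newBlock (suc n) t')) lc)))
  ...   | shelf' , av' | inj₁ i<spine = subst (λ k → insert (suc n) i t' ∈ shelves (suc n) k)
            (trans (sym (leftChildren-join (suc n) i t' i<spine)) lc)
            (∈-++⁺ʳ (map (newBlock (suc n)) (shelves n _))
              (∈-joined⁺ (joined-at (complete n (leftChildren t') t' (shelf' , av' , refl)) i<spine)))

  -- no tree is listed twice, since insertion is injective
  unique : ∀ n k → Unique (shelves n k)
  unique-joined : ∀ n k → Unique (joined n k)

  unique zero    zero    = [] ∷ []
  unique zero    (suc k) = []
  unique (suc n) k       =
    Unique.++⁺ (unique-map (newBlock (suc n)) (unique n k) same-parent) (unique-joined n k) disjoint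
    where
    same-parent : ∀ {t t'} → t ∈ shelves n k → t' ∈ shelves n k → newBlock (suc n) t ≡ newBlock (suc n) t' → t ≡ t'
    same-parent {t} {t'} t∈ t'∈ eq =
      proj₂ (insert-injective (spine t) (spine t') t t' (below-listed t∈) (below-listed t'∈) ℕ.≤-refl ℕ.≤-refl eq)
    disjoint : ∀ {z} → ¬ (z ∈ map (newBlock (suc n)) (shelves n k) × z ∈ joined n k)
    disjoint (z∈opened , z∈joined) with ∈-map⁻ (newBlock (suc n)) z∈opened | ∈-joined⁻ {n} {k} z∈joined
    ... | t , t∈ , eq | joined-at {t = t'} {i} t'∈ i<spine
      with insert-injective (spine t) i t t' (below-listed t∈) (below-listed t'∈) ℕ.≤-refl (ℕ.<⇒≤ i<spine) (sym eq)
    ... | refl , refl = ℕ.<-irrefl refl i<spine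

  unique-joined n zero    = []
  unique-joined n (suc k) = unique-concatMap (joins (suc n)) (unique n k) unique-joins same-parent
    where
    unique-joins : ∀ {t} → t ∈ shelves n k → Unique (joins (suc n) t)
    unique-joins {t} t∈ = unique-map (λ i → insert (suc n) i t) (Unique.upTo⁺ (spine t))
      λ i∈ j∈ eq → proj₁ (insert-injective _ _ t t (below-listed t∈) (below-listed t∈)
                              (ℕ.<⇒≤ (∈-upTo⁻ i∈)) (ℕ.<⇒≤ (∈-upTo⁻ j∈)) eq)
    same-parent : ∀ {t t' z} → t ∈ shelves n k → t' ∈ shelves n k →
                  z ∈ joins (suc n) t → z ∈ joins (suc n) t' → t ≡ t'
    same-parent {t} {t'} t∈ t'∈ z∈ z∈' with ∈-map⁻ (λ i → insert (suc n) i t) z∈ | ∈-map⁻ (λ i → insert (suc n) i t') z∈'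
    ... | i , i∈ , refl | j , j∈ , eq = proj₂ (insert-injective i j t t' (below-listed t∈) (below-listed t'∈)
                                          (ℕ.<⇒≤ (∈-upTo⁻ i∈)) (ℕ.<⇒≤ (∈-upTo⁻ j∈)) eq)

  spine-listed : ∀ n k t → t ∈ shelves n k → spine t + k ≡ n
  spine-listed zero    zero t (here refl) = refl
  spine-listed (suc n) k  t t∈ with ∈-++⁻ (map (newBlock (suc n)) (shelves n k)) t∈
  ... | inj₁ t∈opened with ∈-map⁻ (newBlock (suc n)) t∈opened
  ...   | t' , t'∈ , refl rewrite spine-newBlock (suc n) t' = cong suc (spine-listed n k t' t'∈)
  spine-listed (suc n) k t t∈ | inj₂ t∈joined with ∈-joined⁻ {n} {k} t∈joined
  ... | joined-at {k = k'} {t = t'} {i} t'∈ i<spine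
    rewrite spine-join (suc n) i t' i<spine | ℕ.+-suc (spine t') k' = cong suc (spine-listed n k' t' t'∈)

  length-joins : ∀ {n k t} → t ∈ shelves n k → length (joins (suc n) t) ≡ n ∸ k
  length-joins {n} {k} {t} t∈ = begin
      length (map (λ i → insert (suc n) i t) (upTo (spine t)))  ≡⟨ List.length-map _ (upTo (spine t)) ⟩
      length (upTo (spine t))                                   ≡⟨ List.length-upTo (spine t) ⟩
      spine t                                                   ≡⟨ ℕ.m+n∸n≡m (spine t) k ⟨
      spine t + k ∸ k                                           ≡⟨ cong (_∸ k) (spine-listed n k t t∈) ⟩
      n ∸ k                                                     ∎
    where open ≡-Reasoning

  length-shelves : ∀ n k → length (shelves n k) ≡ shelfCount n k
  length-shelves zero    zero    = refl
  length-shelves zero    (suc k) = refl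
  length-shelves (suc n) zero
    rewrite List.++-identityʳ (map (newBlock (suc n)) (shelves n zero))
          | List.length-map (newBlock (suc n)) (shelves n zero) = length-shelves n zero
  length-shelves (suc n) (suc k)
    rewrite List.length-++ (map (newBlock (suc n)) (shelves n (suc k))) {joined n (suc k)}
          | List.length-map (newBlock (suc n)) (shelves n (suc k))
          | length-concatMap (joins (suc n)) (n ∸ k) (shelves n k) (length-joins {n} {k})
          | length-shelves n (suc k) | length-shelves n k = refl

  shelves-members : ∀ n k t → (t ∈ shelves n k) ⇔ Shelf n k t
  shelves-members n k t = mk⇔ (sound n k t) (complete n k t)

open Counting using (shelfCount)
open Series using (overFact; targetPS-coefficient)
open ListFacts using (same-length)
open Enumeration using (shelves; unique; shelves-members; length-shelves)
open import Function.Construct.Symmetry using (⇔-sym)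
open import Function.Construct.Composition using (_⇔-∘_)
open import Relation.Binary.PropositionalEquality using (cong; module ≡-Reasoning)

theorem1 : (n k : ℕ) (L : List Tree) → Unique L
    → (∀ t → (t ∈ L) ⇔ (IsTShelf n t × AvoidsP t × leftChildren t ≡ k))
    → _/_ (+ length L) (n !) {{n !≢0}} ≡ targetPS n k
theorem1 n k L L! members = begin
    overFact (length L) n                  ≡⟨ cong (λ m → overFact m n) same-count ⟩
    overFact (length (shelves n k)) n      ≡⟨ cong (λ m → overFact m n) (length-shelves n k) ⟩
    overFact (shelfCount n k) n            ≡⟨ targetPS-coefficient n k ⟨
    targetPS n k                           ∎
  where
  open ≡-Reasoning
  same-count : length L ≡ length (shelves n k)
  same-count = same-length L! (unique n k) (λ t → ⇔-sym (shelves-members n k t) ⇔-∘ members t)
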